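{- Let $P=(X,\le)$ be a poset and $\mathcal{M}$ a collection of subsets of $X$ containing all singletons. A subset $U\subseteq X$ belongs to $\tau_{\mathcal{M}}$ if and only if (1) $U=\uparrow U$, and (2) for every $M\in\mathcal{M}_\vee$ with $\bigvee M\in U$ there is a finite subset $N\subseteq M$ with $\operatorname{ub}(N)\subseteq U$.
   Context: $\operatorname{ub}(A)$ is the set of upper bounds of $A$; $\mathcal{M}_\vee$ is the set of members of $\mathcal{M}$ having a supremum in $P$. A net $n=(x_i)_{i\in I}$ is a map from a directed preordered set into $X$; $\operatorname{elb}(n)$ is the set of eventual lower bounds ($x$ with $x\le x_i$ for all $i\ge i_0$ for some $i_0$). $n$ $\mathcal{M}$-converges to $x$ if there is $M\in\mathcal{M}_\vee$ with $M\subseteq\operatorname{elb}(n)$ and $x\le\bigvee M$. $\tau_{\mathcal{M}}$ is the topology induced by $\mathcal{M}$-convergence: $U\in\tau_{\mathcal{M}}$ iff whenever $n$ $\mathcal{M}$-converges to $x\in U$, $x_i\in U$ eventually. -}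

module Defs where

open import Level using (Level; suc)
open import Data.Product using (Σ; ∃; _×_; _,_)
open import Data.List using (List)
open import Data.List.Relation.Unary.All using (All)
open import Relation.Unary using (Pred; _∈_; _⊆_)
open import Relation.Binary using (Rel; IsPreorder)
open import Relation.Binary.PropositionalEquality using (_≡_)

record DirectedSet (ℓ : Level) : Set (suc ℓ) where
  field
    Carrier    : Set ℓ
    _≼_        : Rel Carrier ℓ
    isPreorder : IsPreorder _≡_ _≼_
    inhabited  : Carrier
    directed   : ∀ i j → ∃ λ k → (i ≼ k) × (j ≼ k)

record Net {ℓ : Level} (X : Set ℓ) : Set (suc ℓ) where
  field
    I   : DirectedSet ℓ
    at  : DirectedSet.Carrier I → X

module _ {ℓ : Level} {X : Set ℓ} (_≤_ : Rel X ℓ) where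

  ub : Pred X ℓ → Pred X ℓ
  ub A y = ∀ a → a ∈ A → a ≤ y

  IsSup : Pred X ℓ → X → Set ℓ
  IsSup A s = (s ∈ ub A) × (∀ u → u ∈ ub A → s ≤ u)

  elb : Net X → Pred X ℓ
  elb n y = ∃ λ i₀ → ∀ i → i₀ ≼ i → y ≤ Net.at n i
    where open DirectedSet (Net.I n)

  MConverges : Pred (Pred X ℓ) ℓ → Net X → X → Set (suc ℓ)
  MConverges 𝓜 n x =
    Σ (Pred X ℓ) λ M → ∃ λ s → 𝓜 M × IsSup M s × (M ⊆ elb n) × (x ≤ s)

  Eventually : Net X → Pred X ℓ → Set ℓ
  Eventually n U = ∃ λ i₀ → ∀ i → i₀ ≼ i → Net.at n i ∈ U
    where open DirectedSet (Net.I n)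

  τ : Pred (Pred X ℓ) ℓ → Pred (Pred X ℓ) (suc ℓ)
  τ 𝓜 U = ∀ (n : Net X) x → MConverges 𝓜 n x → x ∈ U → Eventually n U

  ↑ : Pred X ℓ → Pred X ℓ
  ↑ U y = ∃ λ x → x ∈ U × x ≤ y

  _≐_ : Pred X ℓ → Pred X ℓ → Set ℓ
  U ≐ V = (U ⊆ V) × (V ⊆ U)

  ubList : List X → Pred X ℓ
  ubList N y = All (_≤ y) N

  Cond2 : Pred (Pred X ℓ) ℓ → Pred X ℓ → Set (suc ℓ)
  Cond2 𝓜 U = ∀ (M : Pred X ℓ) (s : X) → 𝓜 M → IsSup M s → s ∈ U →
    ∃ λ (N : List X) → All (_∈ M) N × (ubList N ⊆ U)

module Submission where

-- (⇒) Probe an open U with two kinds of nets.  The constant net at y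
-- 𝓜-converges (via the singleton {y} ∈ 𝓜) to every x ≤ y, so x ∈ U forces
-- y ∈ U: U is an upper set.  For M ∈ 𝓜_∨ we build the "finite-subset net"
-- indexed by pairs (N, y) with N a finite subset of M and y an upper bound
-- of N, sending (N, y) to y.  Every element of M is an eventual lower bound,
-- so the net 𝓜-converges to ⋁M; if ⋁M ∈ U the net is eventually in U, and
-- the index where this starts yields the finite N with ub(N) ⊆ U.
--
-- (⇐) If a net 𝓜-converges to x ∈ U through M, then ⋁M ∈ U (U is an upper
-- set), condition (2) gives a finite N ⊆ M with ub(N) ⊆ U, and since
-- finitely many eventual lower bounds are eventually simultaneous lower
-- bounds (directedness), the net is eventually in ub(N) ⊆ U.

open import Defs
open import Level using (Level)
open import Data.Product using (_×_; _,_; Σ; ∃)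
open import Relation.Unary using (Pred; _∈_; _⊆_)
open import Relation.Binary using (Rel; IsPartialOrder; IsPreorder; Reflexive)
open import Relation.Binary.PropositionalEquality using (_≡_; refl; isEquivalence)
open import Function.Bundles using (_⇔_; mk⇔)
open import Data.List using (List; []; _∷_; _++_)
open import Data.List.Relation.Unary.All as All using (All; []; _∷_)
open import Data.List.Relation.Unary.All.Properties using (++⁺)
open import Data.List.Relation.Unary.Any using (here)
open import Data.List.Membership.Propositional as List using ()
open import Data.List.Membership.Propositional.Properties using (∈-++⁺ˡ; ∈-++⁺ʳ)
open import Data.Unit.Polymorphic using (⊤; tt)

module _ {ℓ : Level} {X : Set ℓ} where

  constNet : X → Net X
  constNet y = record
    { I  = record
      { Carrier    = ⊤
      ; _≼_        = λ _ _ → ⊤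
      ; isPreorder = record
        { isEquivalence = isEquivalence ; reflexive = λ _ → tt ; trans = λ _ _ → tt }
      ; inhabited  = tt
      ; directed   = λ _ _ → tt , tt , tt
      }
    ; at = λ _ → y
    }

-- Everything below only uses reflexivity of ≤ (and no order axiom at all
-- for the converse direction).
module _ {ℓ : Level} {X : Set ℓ} (_≤_ : Rel X ℓ) where

  elb-finite : (n : Net X) (N : List X) → All (elb _≤_ n) N →
    ∃ λ i₀ → ∀ i → DirectedSet._≼_ (Net.I n) i₀ i → ubList _≤_ N (Net.at n i)
  elb-finite n = go
    where
      open DirectedSet (Net.I n)
      open IsPreorder isPreorder using (trans)

      go : (N : List X) → All (elb _≤_ n) N →
        ∃ λ i₀ → ∀ i → i₀ ≼ i → ubList _≤_ N (Net.at n i)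
      go []      []               = inhabited , λ _ _ → []
      go (a ∷ N) ((j , a≤) ∷ N≤) with go N N≤
      ... | k , N≤ₖ with directed j k
      ...   | l , j≼l , k≼l = l , λ i l≼i → a≤ i (trans j≼l l≼i) ∷ N≤ₖ i (trans k≼l l≼i)

  ub-finite : ∀ {M s} → s ∈ ub _≤_ M → ∀ {N} → All (_∈ M) N → ubList _≤_ N s
  ub-finite s-ub = All.map (λ {a} → s-ub a)

  -- Directedness
  -- holds because s bounds every union of two finite subsets.
  module FiniteSubsetNet (M : Pred X ℓ) (s : X) (s-ub : s ∈ ub _≤_ M) where

    Index : Set ℓ
    Index = Σ (List X) λ N → All (_∈ M) N × Σ X (ubList _≤_ N)

    _⊑_ : Index → Index → Set ℓ
    (N , _) ⊑ (N′ , _) = ∀ {a} → a List.∈ N → a List.∈ N′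

    directed : ∀ i j → ∃ λ k → (i ⊑ k) × (j ⊑ k)
    directed (N , N⊆M , _) (N′ , N′⊆M , _) =
      (N ++ N′ , N∪N′⊆M , s , ub-finite s-ub N∪N′⊆M) , ∈-++⁺ˡ , ∈-++⁺ʳ N
      where N∪N′⊆M = ++⁺ N⊆M N′⊆M

    net : Net X
    net = record
      { I  = record
        { Carrier    = Index
        ; _≼_        = _⊑_
        ; isPreorder = record
          { isEquivalence = isEquivalence
          ; reflexive     = λ { refl a∈ → a∈ }
          ; trans         = λ i⊑j j⊑k a∈ → j⊑k (i⊑j a∈)
          }
        ; inhabited  = [] , [] , s , []
        ; directed   = directed
        }
      ; at = λ { (_ , _ , y , _) → y }
      }

    -- Each a ∈ M is an eventual lower bound: from the index {a} on, the
    -- net takes values among upper bounds of sets containing a.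
    M⊆elb : Reflexive _≤_ → M ⊆ elb _≤_ net
    M⊆elb ≤-refl {a} a∈M =
      (a ∷ [] , a∈M ∷ [] , a , ≤-refl ∷ []) ,
      λ { (_ , _ , y , y-ub) a∈⊆N → All.lookup y-ub (a∈⊆N (here refl)) }

  module _ (≤-refl : Reflexive _≤_) (𝓜 : Pred (Pred X ℓ) ℓ)
           (singletons : ∀ x → 𝓜 (λ y → y ≡ x)) (U : Pred X ℓ) where

    singleton-sup : ∀ y → IsSup _≤_ (λ z → z ≡ y) y
    singleton-sup y = (λ { _ refl → ≤-refl }) , (λ u u-ub → u-ub y refl)

    constNet-converges : ∀ {x y} → x ≤ y → MConverges _≤_ 𝓜 (constNet y) x
    constNet-converges {y = y} x≤y =
      (λ z → z ≡ y) , y , singletons y , singleton-sup y ,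
      (λ { refl → tt , λ _ _ → ≤-refl }) , x≤y

    open⇒upper : U ∈ τ _≤_ 𝓜 → _≐_ _≤_ U (↑ _≤_ U)
    open⇒upper U-open =
      (λ {x} x∈U → x , x∈U , ≤-refl) ,
      λ { {y} (x , x∈U , x≤y) →
            let i₀ , eventually = U-open (constNet y) x (constNet-converges x≤y) x∈U
            in eventually i₀ tt }

    open⇒cond2 : U ∈ τ _≤_ 𝓜 → Cond2 _≤_ 𝓜 U
    open⇒cond2 U-open M s M∈𝓜 s-sup@(s-ub , _) s∈U
      with U-open net s (M , s , M∈𝓜 , s-sup , M⊆elb ≤-refl , ≤-refl) s∈U
      where open FiniteSubsetNet M s s-ub
    ... | (N , N⊆M , _) , eventually =
      N , N⊆M , λ {y} y-ub → eventually (N , N⊆M , y , y-ub) (λ a∈ → a∈)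

  upper×cond2⇒open : ∀ 𝓜 U → _≐_ _≤_ U (↑ _≤_ U) × Cond2 _≤_ 𝓜 U → U ∈ τ _≤_ 𝓜
  upper×cond2⇒open 𝓜 U ((_ , ↑U⊆U) , cond2) n x (M , s , M∈𝓜 , s-sup , M⊆elb , x≤s) x∈U
    with cond2 M s M∈𝓜 s-sup (↑U⊆U (x , x∈U , x≤s))
  ... | N , N⊆M , ubN⊆U with elb-finite n N (All.map M⊆elb N⊆M)
  ...   | i₀ , N≤ = i₀ , λ i i₀≼i → ubN⊆U (N≤ i i₀≼i)

lemma3p4 : ∀ {ℓ : Level} {X : Set ℓ} (_≤_ : Rel X ℓ) → IsPartialOrder _≡_ _≤_ →
    (𝓜 : Pred (Pred X ℓ) ℓ) → (∀ x → 𝓜 (λ y → y ≡ x)) →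
    (U : Pred X ℓ) →
    (U ∈ τ _≤_ 𝓜) ⇔ ((_≐_ _≤_ U (↑ _≤_ U)) × Cond2 _≤_ 𝓜 U)
lemma3p4 _≤_ po 𝓜 singletons U =
  mk⇔ (λ U-open → open⇒upper _≤_ ≤-refl 𝓜 singletons U U-open ,
                  open⇒cond2 _≤_ ≤-refl 𝓜 singletons U U-open)
      (upper×cond2⇒open _≤_ 𝓜 U)
  where open IsPartialOrder po using () renaming (refl to ≤-refl)
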